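{- Let $G$ be an ordered graph, let $B \subset V(G)$ be a homogeneous block of size at most $2$, and let $v \in B$. Then $T(G - v) \neq T(G)$.
   Context: An ordered graph is a graph with a linear order on its vertices, identified with one on $[n]$ with the usual order; $G - v$ is the induced ordered subgraph on $V(G)\setminus\{v\}$. For $x,y \in V(G)$ write $x \sim y$ if $\Gamma(x)\setminus\{y\} = \Gamma(y)\setminus\{x\}$. A homogeneous block is a maximal set of consecutive vertices of $G$ any two of which satisfy $x\sim y$. If the homogeneous blocks are $B_1 < \cdots < B_k$, let $H(G)$ be the graph with loops on $[k]$ with $ij \in E(H(G))$ iff $u_iu_j \in E(G)$ for all $u_i \in B_i, u_j \in B_j$, and $b_G \in \{1,2\}^k$ with $b_i = 1$ if $|B_i|=1$ and $b_i=2$ otherwise. The type of $G$ is $T(G) = (H(G), b_G)$. -}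

module Defs where

open import Data.Nat using (ℕ; suc)
open import Data.Bool using (Bool; true; false)
open import Data.Fin using (Fin; _<_; _≤_; punchIn)
open import Data.Fin.Subset using (Subset; _∈_; _⊆_; ∣_∣; Nonempty)
open import Data.Product using (_×_; Σ; ∃)
open import Relation.Binary.PropositionalEquality using (_≡_; _≢_)
open import Relation.Nullary using (¬_)
open import Function.Bundles using (_⇔_)

-- An ordered (simple) graph on the vertex set [n] = Fin n, with its usual order.
record OGraph (n : ℕ) : Set where
  field
    adj    : Fin n → Fin n → Bool
    sym    : ∀ x y → adj x y ≡ adj y x
    irrefl : ∀ x → adj x x ≡ false
open OGraph public

-- G - v : induced ordered subgraph on V(G) \ {v}, relabelled order-preservingly
-- onto [n] via punchIn v.
_-ᵥ_ : ∀ {n} → OGraph (suc n) → Fin (suc n) → OGraph n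
adj    (G -ᵥ v) i j = adj G (punchIn v i) (punchIn v j)
sym    (G -ᵥ v) i j = sym G (punchIn v i) (punchIn v j)
irrefl (G -ᵥ v) i   = irrefl G (punchIn v i)

Sim : ∀ {n} → OGraph n → Fin n → Fin n → Set
Sim G x y = ∀ z → ((adj G x z ≡ true × z ≢ y) ⇔ (adj G y z ≡ true × z ≢ x))

Consecutive : ∀ {n} → Subset n → Set
Consecutive {n} B = ∀ (x y z : Fin n) → x ∈ B → z ∈ B → x ≤ y → y ≤ z → y ∈ B

PairwiseSimInterval : ∀ {n} → OGraph n → Subset n → Set
PairwiseSimInterval G B = Consecutive B × (∀ x y → x ∈ B → y ∈ B → Sim G x y)

HomBlock : ∀ {n} → OGraph n → Subset n → Set
HomBlock {n} G B =
  Nonempty B × PairwiseSimInterval G B ×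
  (∀ (B' : Subset n) → PairwiseSimInterval G B' → B ⊆ B' → B' ⊆ B)

-- HasType G k H b :  T(G) = (H , b), where H is a graph with loops on [k]
-- (given by its adjacency function) and b ∈ {1,2}^k.
-- Witnessed by the list B_1 < ... < B_k of all homogeneous blocks of G.
-- Loops: ii ∈ E(H) iff u u' ∈ E(G) for all distinct u, u' ∈ B_i
-- (in general: for all u ∈ B_i, u' ∈ B_j with u ≢ u').
HasType : ∀ {n} → OGraph n → (k : ℕ) → (Fin k → Fin k → Bool) → (Fin k → ℕ) → Set
HasType {n} G k H b =
  Σ (Fin k → Subset n) λ Bl →
    (∀ i → HomBlock G (Bl i)) ×
    (∀ B → HomBlock G B → ∃ λ i → Bl i ≡ B) ×
    (∀ i j → i < j → ∀ x y → x ∈ Bl i → y ∈ Bl j → x < y) ×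
    (∀ i j → (H i j ≡ true) ⇔ (∀ u w → u ∈ Bl i → w ∈ Bl j → u ≢ w → adj G u w ≡ true)) ×
    (∀ i → (∣ Bl i ∣ ≡ 1 → b i ≡ 1) × (¬ (∣ Bl i ∣ ≡ 1) → b i ≡ 2))

module Submission where

-- Suppose G and G' = G - v both have type (H , b), with k blocks.  The part of
-- a G-block surviving the deletion is a consecutive set of pairwise twins of G',
-- so by maximality it lies in a single G'-block.  This gives a map `absorb`
-- from G-blocks to G'-blocks, onto since every vertex lies in some block.
--   * If B = {v}, nothing of B survives: k - 1 blocks map onto k blocks.
--   * If B = {v , w}, every block survives and `absorb` is a weakly monotone
--     surjection of Fin k onto itself, hence the identity.  The G'-block with
--     the index of B is then {w}: b records size 1 there for G - v but size 2
--     for G.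

open import Defs hiding (sym)
open import Data.Nat as ℕ using (ℕ; zero; suc; z≤n; s≤s)
import Data.Nat.Properties as ℕ
open import Data.Bool using (Bool; true)
open import Data.Bool.Properties using (T-≡; ⇔→≡) renaming (_≟_ to _≟ᵇ_)
open import Data.Fin using (Fin; zero; suc; _<_; _≤_; toℕ; inject₁; punchIn; punchOut)
open import Data.Fin.Properties
  using (_≟_; _≤?_; all?; any?; ≤-refl; ≤-trans; ≤-total; ≤-antisym; ≤-reflexive; toℕ-injective;
         toℕ-inject₁; ≤̄⇒inject₁<; ≤∧≢⇒<; <⇒≢; <-cmp; injective⇒≤;
         punchIn-injective; punchIn-mono-≤; punchIn-punchOut; punchInᵢ≢i)
open import Data.Fin.Subset using (Subset; _∈_; _∉_; ∣_∣; _-_; ⁅_⁆)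
open import Data.Fin.Subset.Properties
  using (_∈?_; x∈p⇒∣p-x∣<∣p∣; x∈p∧x≢y⇒x∈p-y; p⊆q⇒∣p∣≤∣q∣; ∣⁅x⁆∣≡1; x∈⁅x⁆)
open import Data.Vec using (tabulate)
open import Data.Vec.Properties using (lookup∘tabulate; []=⇒lookup; lookup⇒[]=)
open import Data.Product using (_×_; ∃; _,_; proj₁; proj₂)
open import Data.Sum using (_⊎_; inj₁; inj₂; [_,_]′)
open import Data.Empty using (⊥)
open import Function using (case_of_)
open import Function.Bundles using (mk⇔; Equivalence)
open import Relation.Binary.PropositionalEquality
  using (_≡_; _≢_; refl; sym; trans; cong; subst; subst₂; module ≡-Reasoning)
open import Relation.Nullary using (¬_; Dec; yes; no; contradiction)
open import Relation.Nullary.Decidable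
  using (isYes; toWitness; fromWitness; ¬?; _→-dec_; _×-dec_; _⊎-dec_)
open import Relation.Unary using (Decidable)
open import Relation.Binary using (tri<; tri≈; tri>)

Onto : ∀ {m n} → (Fin m → Fin n) → Set
Onto f = ∀ j → ∃ λ i → f i ≡ j

StrictlyMonotone : ∀ {m n} → (Fin m → Fin n) → Set
StrictlyMonotone f = ∀ {i j} → i < j → f i < f j

-- A surjection Fin m → Fin n forces n ≤ m, since a chosen section is injective.
onto⇒≤ : ∀ {m n} (f : Fin m → Fin n) → Onto f → n ℕ.≤ m
onto⇒≤ f onto = injective⇒≤ {f = λ j → proj₁ (onto j)} section-injective
  where
  section-injective : ∀ {j j'} → proj₁ (onto j) ≡ proj₁ (onto j') → j ≡ j'
  section-injective {j} {j'} eq =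
    trans (sym (proj₂ (onto j))) (trans (cong f eq) (proj₂ (onto j')))

punctured-not-onto : ∀ {k} (p : Fin k) (g : Fin k → Fin k) →
  (∀ j → ∃ λ i → i ≢ p × g i ≡ j) → ⊥
punctured-not-onto {suc k} p g onto = ℕ.1+n≰n (onto⇒≤ (λ i → g (punchIn p i)) onto')
  where
  onto' : Onto (λ i → g (punchIn p i))
  onto' j with onto j
  ... | i , i≢p , gi≡j =
    punchOut (λ p≡i → i≢p (sym p≡i)) ,
    trans (cong g (punchIn-punchOut (λ p≡i → i≢p (sym p≡i)))) gi≡j

-- A surjective endomap of Fin k is injective: if a ≢ c had the same image,
-- the map would stay onto with a left out.
onto⇒injective : ∀ {k} (F : Fin k → Fin k) → Onto F → ∀ {a c} → F a ≡ F c → a ≡ c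
onto⇒injective F onto {a} {c} Fa≡Fc with a ≟ c
... | yes a≡c = a≡c
... | no a≢c = contradiction onto-without-a (punctured-not-onto a F)
  where
  onto-without-a : ∀ j → ∃ λ i → i ≢ a × F i ≡ j
  onto-without-a j with onto j
  ... | i , Fi≡j with i ≟ a
  ...   | no i≢a = i , i≢a , Fi≡j
  ...   | yes refl = c , (λ c≡a → a≢c (sym c≡a)) , trans (sym Fa≡Fc) Fi≡j

strictlyMonotone⇒≥ : ∀ {m n} (f : Fin m → Fin n) → StrictlyMonotone f →
  ∀ i → toℕ i ℕ.≤ toℕ (f i)
strictlyMonotone⇒≥ f mono zero = z≤n
strictlyMonotone⇒≥ f mono (suc i) =
  ℕ.≤-trans (s≤s (strictlyMonotone⇒≥ (λ a → f (inject₁ a)) (λ a<b → mono (inject₁-mono a<b)) i))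
            (mono (≤̄⇒inject₁< ≤-refl))
  where
  inject₁-mono : ∀ {n} {a b : Fin n} → a < b → inject₁ a < inject₁ b
  inject₁-mono {a = a} {b} = subst₂ ℕ._<_ (sym (toℕ-inject₁ a)) (sym (toℕ-inject₁ b))

-- A weakly monotone surjective endomap F of Fin k is the identity: F is
-- injective, hence strictly monotone; so is a section of F; and neither of the
-- two moves a point down.
monotoneOnto⇒id : ∀ {k} (F : Fin k → Fin k) → (∀ {i j} → i ≤ j → F i ≤ F j) →
  Onto F → ∀ i → F i ≡ i
monotoneOnto⇒id {k} F mono onto i = toℕ-injective (ℕ.≤-antisym F-down F-up)
  where
  section : Fin k → Fin k
  section j = proj₁ (onto j)

  F∘section : ∀ j → F (section j) ≡ j
  F∘section j = proj₂ (onto j)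

  F-strict : StrictlyMonotone F
  F-strict a<c = ≤∧≢⇒< (mono (ℕ.<⇒≤ a<c)) (λ Fa≡Fc → <⇒≢ a<c (onto⇒injective F onto Fa≡Fc))

  section-strict : StrictlyMonotone section
  section-strict {j} {j'} j<j' = ℕ.≰⇒> λ s'≤s →
    ℕ.<⇒≱ j<j' (subst₂ _≤_ (F∘section j') (F∘section j) (mono s'≤s))

  F-up : toℕ i ℕ.≤ toℕ (F i)
  F-up = strictlyMonotone⇒≥ F F-strict i

  F-down : toℕ (F i) ℕ.≤ toℕ i
  F-down = subst (λ x → toℕ (F i) ℕ.≤ toℕ x)
                 (onto⇒injective F onto (F∘section (F i)))
                 (strictlyMonotone⇒≥ section section-strict (F i))

suc≤∣p∣ : ∀ {m} {p : Subset m} {x c} → x ∈ p → c ℕ.≤ ∣ p - x ∣ → suc c ℕ.≤ ∣ p ∣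
suc≤∣p∣ x∈p c≤ = ℕ.≤-trans (s≤s c≤) (x∈p⇒∣p-x∣<∣p∣ x∈p)

one≤∣p∣ : ∀ {m} {p : Subset m} {x} → x ∈ p → 1 ℕ.≤ ∣ p ∣
one≤∣p∣ x∈p = suc≤∣p∣ x∈p z≤n

two≤∣p∣ : ∀ {m} {p : Subset m} {x y} → x ∈ p → y ∈ p → x ≢ y → 2 ℕ.≤ ∣ p ∣
two≤∣p∣ x∈p y∈p x≢y = suc≤∣p∣ x∈p (one≤∣p∣ (x∈p∧x≢y⇒x∈p-y y∈p (λ y≡x → x≢y (sym y≡x))))

three≤∣p∣ : ∀ {m} {p : Subset m} {x y z} → x ∈ p → y ∈ p → z ∈ p →
  x ≢ y → x ≢ z → y ≢ z → 3 ℕ.≤ ∣ p ∣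
three≤∣p∣ x∈p y∈p z∈p x≢y x≢z y≢z = suc≤∣p∣ x∈p
  (two≤∣p∣ (x∈p∧x≢y⇒x∈p-y y∈p (λ y≡x → x≢y (sym y≡x)))
           (x∈p∧x≢y⇒x∈p-y z∈p (λ z≡x → x≢z (sym z≡x))) y≢z)

atMostTwo : ∀ {m} {p : Subset m} {x y z} → ∣ p ∣ ℕ.≤ 2 → x ∈ p → y ∈ p → z ∈ p →
  x ≢ y → x ≢ z → y ≡ z
atMostTwo {y = y} {z} ∣p∣≤2 x∈p y∈p z∈p x≢y x≢z with y ≟ z
... | yes y≡z = y≡z
... | no y≢z = contradiction (three≤∣p∣ x∈p y∈p z∈p x≢y x≢z y≢z) (ℕ.≤⇒≯ ∣p∣≤2)

∣p∣≡1 : ∀ {m} {p : Subset m} {w} → w ∈ p → (∀ {u} → u ∈ p → u ≡ w) → ∣ p ∣ ≡ 1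
∣p∣≡1 {p = p} {w} w∈p only = ℕ.≤-antisym
  (subst (∣ p ∣ ℕ.≤_) (∣⁅x⁆∣≡1 w)
    (p⊆q⇒∣p∣≤∣q∣ λ u∈p → subst (_∈ ⁅ w ⁆) (sym (only u∈p)) (x∈⁅x⁆ w)))
  (one≤∣p∣ w∈p)

module _ {m : ℕ} (G : OGraph m) where

  -- x and y are twins: they agree on every third vertex.  This is `Sim`
  -- with the exclusions made explicit; unlike `Sim` it is visibly an
  -- equivalence relation.
  Twins : Fin m → Fin m → Set
  Twins x y = ∀ t → t ≢ x → t ≢ y → adj G x t ≡ adj G y t

  neighbour≢ : ∀ {x t} → adj G x t ≡ true → t ≢ x
  neighbour≢ {x} x~t refl = contradiction (trans (sym x~t) (irrefl G x)) (λ ())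

  sim⇒twins : ∀ {x y} → Sim G x y → Twins x y
  sim⇒twins x≈y t t≢x t≢y = ⇔→≡ {z = true} (mk⇔
    (λ x~t → proj₁ (Equivalence.to   (x≈y t) (x~t , t≢y)))
    (λ y~t → proj₁ (Equivalence.from (x≈y t) (y~t , t≢x))))

  twins⇒sim : ∀ {x y} → Twins x y → Sim G x y
  twins⇒sim x≈y t = mk⇔
    (λ (x~t , t≢y) → let t≢x = neighbour≢ x~t in trans (sym (x≈y t t≢x t≢y)) x~t , t≢x)
    (λ (y~t , t≢x) → let t≢y = neighbour≢ y~t in trans (x≈y t t≢x t≢y) y~t , t≢y)

  twins-refl : ∀ {x} → Twins x x
  twins-refl t _ _ = refl

  twins-sym : ∀ {x y} → Twins x y → Twins y x
  twins-sym x≈y t t≢y t≢x = sym (x≈y t t≢x t≢y)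

  -- At t = y the chain goes through x and z instead, using symmetry of adj.
  twins-trans : ∀ {x y z} → Twins x y → Twins y z → Twins x z
  twins-trans {x} {y} {z} x≈y y≈z t t≢x t≢z with x ≟ z | t ≟ y
  ... | yes refl | _        = refl
  ... | no x≢z   | no t≢y   = trans (x≈y t t≢x t≢y) (y≈z t t≢y t≢z)
  ... | no x≢z   | yes refl = begin
    adj G x t ≡⟨ OGraph.sym G x t ⟩
    adj G t x ≡⟨ y≈z x (λ x≡t → t≢x (sym x≡t)) x≢z ⟩
    adj G z x ≡⟨ OGraph.sym G z x ⟩
    adj G x z ≡⟨ x≈y z (λ z≡x → x≢z (sym z≡x)) (λ z≡t → t≢z (sym z≡t)) ⟩
    adj G t z ≡⟨ OGraph.sym G t z ⟩
    adj G z t ∎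
    where open ≡-Reasoning

  twins? : ∀ x y → Dec (Twins x y)
  twins? x y = all? λ t → ¬? (t ≟ x) →-dec ¬? (t ≟ y) →-dec (adj G x t ≟ᵇ adj G y t)

  -- A set of pairwise twins that is consecutive in the order, described by a
  -- predicate; for P = (_∈ B) this is literally `PairwiseSimInterval G B`.
  TwinInterval : (Fin m → Set) → Set
  TwinInterval P = (∀ x y z → P x → P z → x ≤ y → y ≤ z → P y) × (∀ x y → P x → P y → Sim G x y)

subsetOf : ∀ {m} {P : Fin m → Set} → Decidable P → Subset m
subsetOf P? = tabulate λ y → isYes (P? y)

∈-subsetOf⁻ : ∀ {m} {P : Fin m → Set} (P? : Decidable P) {y} → y ∈ subsetOf P? → P y
∈-subsetOf⁻ P? {y} y∈ = toWitness (Equivalence.from T-≡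
  (trans (sym (lookup∘tabulate (λ z → isYes (P? z)) y)) ([]=⇒lookup y∈)))

∈-subsetOf⁺ : ∀ {m} {P : Fin m → Set} (P? : Decidable P) {y} → P y → y ∈ subsetOf P?
∈-subsetOf⁺ P? {y} Py = lookup⇒[]= y (subsetOf P?)
  (trans (lookup∘tabulate (λ z → isYes (P? z)) y) (Equivalence.to T-≡ (fromWitness Py)))

module _ {m : ℕ} (G : OGraph m) where

  Between : Fin m → Fin m → Fin m → Set
  Between x y a = (x ≤ a × a ≤ y) ⊎ (y ≤ a × a ≤ x)

  between? : ∀ x y a → Dec (Between x y a)
  between? x y a = ((x ≤? a) ×-dec (a ≤? y)) ⊎-dec ((y ≤? a) ×-dec (a ≤? x))

  between-end : ∀ x y → Between x y y
  between-end x y with ≤-total x y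
  ... | inj₁ x≤y = inj₁ (x≤y , ≤-refl)
  ... | inj₂ y≤x = inj₂ (≤-refl , y≤x)

  between-split : ∀ {x y₁ y₂ y₃ a} → y₁ ≤ y₂ → y₂ ≤ y₃ → Between x y₂ a →
    Between x y₁ a ⊎ Between x y₃ a
  between-split y₁≤y₂ y₂≤y₃ (inj₁ (x≤a , a≤y₂)) = inj₂ (inj₁ (x≤a , ≤-trans a≤y₂ y₂≤y₃))
  between-split y₁≤y₂ y₂≤y₃ (inj₂ (y₂≤a , a≤x)) = inj₁ (inj₂ (≤-trans y₁≤y₂ y₂≤a , a≤x))

  Reaches : Fin m → Fin m → Set
  Reaches x y = ∀ a → Between x y a → Twins G x a

  reaches? : ∀ x y → Dec (Reaches x y)
  reaches? x y = all? λ a → between? x y a →-dec twins? G x a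

  blockOf : Fin m → Subset m
  blockOf x = subsetOf (reaches? x)

  x∈blockOf : ∀ x → x ∈ blockOf x
  x∈blockOf x = ∈-subsetOf⁺ (reaches? x) λ
    { a (inj₁ (x≤a , a≤x)) → subst (Twins G x) (≤-antisym x≤a a≤x) (twins-refl G)
    ; a (inj₂ (x≤a , a≤x)) → subst (Twins G x) (≤-antisym x≤a a≤x) (twins-refl G) }

  blockOf-interval : ∀ x → TwinInterval G (_∈ blockOf x)
  blockOf-interval x = consecutive , pairwise
    where
    reached : ∀ {y} → y ∈ blockOf x → Reaches x y
    reached = ∈-subsetOf⁻ (reaches? x)

    consecutive : ∀ y₁ y₂ y₃ → y₁ ∈ blockOf x → y₃ ∈ blockOf x → y₁ ≤ y₂ → y₂ ≤ y₃ → y₂ ∈ blockOf x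
    consecutive y₁ y₂ y₃ y₁∈ y₃∈ y₁≤y₂ y₂≤y₃ = ∈-subsetOf⁺ (reaches? x) λ a a-between →
      [ reached y₁∈ a , reached y₃∈ a ]′ (between-split y₁≤y₂ y₂≤y₃ a-between)

    pairwise : ∀ y₁ y₂ → y₁ ∈ blockOf x → y₂ ∈ blockOf x → Sim G y₁ y₂
    pairwise y₁ y₂ y₁∈ y₂∈ = twins⇒sim G (twins-trans G
      (twins-sym G (reached y₁∈ y₁ (between-end x y₁))) (reached y₂∈ y₂ (between-end x y₂)))

  interval⊆blockOf : ∀ {P x y} → TwinInterval G P → P x → P y → y ∈ blockOf x
  interval⊆blockOf (consecutive , pairwise) Px Py = ∈-subsetOf⁺ (reaches? _) λ
    { a (inj₁ (x≤a , a≤y)) → sim⇒twins G (pairwise _ _ Px (consecutive _ a _ Px Py x≤a a≤y))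
    ; a (inj₂ (y≤a , a≤x)) → sim⇒twins G (pairwise _ _ Px (consecutive _ a _ Py Px y≤a a≤x)) }

  blockOf-homogeneous : ∀ x → HomBlock G (blockOf x)
  blockOf-homogeneous x =
    (x , x∈blockOf x) , blockOf-interval x ,
    λ B' B'-interval blockOf⊆B' → interval⊆blockOf B'-interval (blockOf⊆B' (x∈blockOf x))

  interval⊆block : ∀ {B P x} → HomBlock G B → x ∈ B → TwinInterval G P → P x →
    ∀ {y} → P y → y ∈ B
  interval⊆block (_ , B-interval , maximal) x∈B P-interval Px Py =
    maximal (blockOf _) (blockOf-interval _) (interval⊆blockOf B-interval x∈B)
      (interval⊆blockOf P-interval Px Py)

module TypeWitness {m} (G : OGraph m) (k : ℕ) (H : Fin k → Fin k → Bool) (b : Fin k → ℕ)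
                   (T : HasType G k H b) where

  blocks : Fin k → Subset m
  blocks = proj₁ T

  homogeneous : ∀ i → HomBlock G (blocks i)
  homogeneous = proj₁ (proj₂ T)

  complete : ∀ B → HomBlock G B → ∃ λ i → blocks i ≡ B
  complete = proj₁ (proj₂ (proj₂ T))

  ordered : ∀ i j → i < j → ∀ x y → x ∈ blocks i → y ∈ blocks j → x < y
  ordered = proj₁ (proj₂ (proj₂ (proj₂ T)))

  sizeLabel : ∀ i → (∣ blocks i ∣ ≡ 1 → b i ≡ 1) × (¬ ∣ blocks i ∣ ≡ 1 → b i ≡ 2)
  sizeLabel = proj₂ (proj₂ (proj₂ (proj₂ (proj₂ T))))

  disjoint : ∀ {x i j} → x ∈ blocks i → x ∈ blocks j → i ≡ j
  disjoint {x} {i} {j} x∈i x∈j with <-cmp i j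
  ... | tri< i<j _ _ = contradiction (ordered i j i<j x x x∈i x∈j) (ℕ.n≮n _)
  ... | tri≈ _ i≡j _ = i≡j
  ... | tri> _ _ j<i = contradiction (ordered j i j<i x x x∈j x∈i) (ℕ.n≮n _)

  -- It is used only through ∈-index; keeping it opaque stops the
  -- type checker from unfolding the construction of that block.
  opaque
    index : Fin m → Fin k
    index x = proj₁ (complete (blockOf G x) (blockOf-homogeneous G x))

    ∈-index : ∀ x → x ∈ blocks (index x)
    ∈-index x = subst (x ∈_) (sym (proj₂ (complete (blockOf G x) (blockOf-homogeneous G x))))
                      (x∈blockOf G x)

  index-unique : ∀ {x i} → x ∈ blocks i → index x ≡ i
  index-unique x∈i = disjoint (∈-index _) x∈i

  index-of-block : ∀ {B x} → HomBlock G B → x ∈ B → blocks (index x) ≡ B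
  index-of-block B-hom x∈B with complete _ B-hom
  ... | i , blocks-i≡B = trans (cong blocks (index-unique (subst (_ ∈_) (sym blocks-i≡B) x∈B))) blocks-i≡B

  index-monotone : ∀ {x y} → x ≤ y → index x ≤ index y
  index-monotone {x} {y} x≤y = ℕ.≮⇒≥ λ iy<ix →
    ℕ.≤⇒≯ x≤y (ordered _ _ iy<ix y x (∈-index y) (∈-index x))

deletion-interval : ∀ {n} (G : OGraph (suc n)) (v : Fin (suc n)) {P : Fin (suc n) → Set} →
  TwinInterval G P → TwinInterval (G -ᵥ v) (λ y → P (punchIn v y))
deletion-interval G v (consecutive , pairwise) =
  (λ x y z Px Pz x≤y y≤z → consecutive _ _ _ Px Pz (punchIn-mono-≤ v x y x≤y) (punchIn-mono-≤ v y z y≤z)) ,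
  (λ x y Px Py → twins⇒sim (G -ᵥ v) λ t t≢x t≢y →
    sim⇒twins G (pairwise _ _ Px Py) (punchIn v t)
      (λ e → t≢x (punchIn-injective v t x e)) (λ e → t≢y (punchIn-injective v t y e)))

module Deletion {n k} {H : Fin k → Fin k → Bool} {b : Fin k → ℕ}
                (G : OGraph (suc n)) (v : Fin (suc n))
                (T : HasType G k H b) (T' : HasType (G -ᵥ v) k H b) where

  open TypeWitness G k H b T
  open TypeWitness (G -ᵥ v) k H b T' using () renaming
    (blocks to blocks'; homogeneous to homogeneous'; sizeLabel to sizeLabel';
     index to index'; ∈-index to ∈-index'; index-unique to index-unique'; index-monotone to index-monotone')

  p : Fin k
  p = index v

  same-block : ∀ {i x' y'} → punchIn v x' ∈ blocks i → punchIn v y' ∈ blocks i → index' x' ≡ index' y'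
  same-block {i} {x'} x'∈i y'∈i = sym (index-unique'
    (interval⊆block (G -ᵥ v) (homogeneous' (index' x')) (∈-index' x')
      (deletion-interval G v (proj₁ (proj₂ (homogeneous i)))) x'∈i y'∈i))

  -- The block of G - v absorbing the survivors of the i-th block of G
  -- (i itself, a value never used, when nothing survives).
  absorb : Fin k → Fin k
  absorb i with any? (λ x' → punchIn v x' ∈? blocks i)
  ... | yes (x' , _) = index' x'
  ... | no _ = i

  absorb-spec : ∀ {i x'} → punchIn v x' ∈ blocks i → absorb i ≡ index' x'
  absorb-spec {i} {x'} x'∈i with any? (λ y' → punchIn v y' ∈? blocks i)
  ... | yes (y' , y'∈i) = same-block y'∈i x'∈i
  ... | no nothing-survives = contradiction (x' , x'∈i) nothing-survives

  absorb-covers : ∀ j → ∃ λ x' → absorb (index (punchIn v x')) ≡ j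
  absorb-covers j =
    let (x' , x'∈j) = proj₁ (homogeneous' j)
    in x' , trans (absorb-spec (∈-index (punchIn v x'))) (index-unique' x'∈j)

  -- If v is alone in its block, k - 1 blocks of G are mapped onto k blocks.
  alone⇒⊥ : (∀ x' → punchIn v x' ∉ blocks p) → ⊥
  alone⇒⊥ alone = punctured-not-onto p absorb λ j → case absorb-covers j of λ
    (x' , absorbed) → index (punchIn v x') ,
                      (λ e → alone x' (subst (λ i → punchIn v x' ∈ blocks i) e (∈-index (punchIn v x')))) ,
                      absorbed

  -- If a second vertex w = punchIn v w' shares the block of v, every block of G
  -- survives, `absorb` is the identity, and the p-th block of G - v is {w'}.
  module WithPartner (w' : Fin n) (w∈p : punchIn v w' ∈ blocks p) (small : ∣ blocks p ∣ ℕ.≤ 2) where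

    v≢w : v ≢ punchIn v w'
    v≢w v≡w = punchInᵢ≢i v w' (sym v≡w)

    -- Every block of G keeps a vertex: w for the block of v, and any of its
    -- vertices (all different from v) for the others.
    survivor : ∀ i → ∃ λ x' → punchIn v x' ∈ blocks i
    survivor i with proj₁ (homogeneous i)
    ... | x , x∈i with v ≟ x
    ...   | yes refl = w' , subst (λ j → punchIn v w' ∈ blocks j) (index-unique x∈i) w∈p
    ...   | no v≢x = punchOut v≢x , subst (_∈ blocks i) (sym (punchIn-punchOut v≢x)) x∈i

    -- Compare survivors x' of block i and y' of block j: if x' ≤ y' their
    -- blocks in G - v are in order; otherwise j ≤ i, so i = j.
    absorb-monotone : ∀ {i j} → i ≤ j → absorb i ≤ absorb j
    absorb-monotone {i} {j} i≤j with survivor i | survivor j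
    ... | x' , x'∈i | y' , y'∈j with ≤-total x' y'
    ...   | inj₁ x'≤y' = subst₂ _≤_ (sym (absorb-spec x'∈i)) (sym (absorb-spec y'∈j)) (index-monotone' x'≤y')
    ...   | inj₂ y'≤x' = ≤-reflexive (cong absorb (≤-antisym i≤j j≤i))
      where
      j≤i : j ≤ i
      j≤i = subst₂ _≤_ (index-unique y'∈j) (index-unique x'∈i) (index-monotone (punchIn-mono-≤ v y' x' y'≤x'))

    absorb-id : ∀ i → absorb i ≡ i
    absorb-id = monotoneOnto⇒id absorb absorb-monotone λ j → case absorb-covers j of λ
      (x' , absorbed) → index (punchIn v x') , absorbed

    w'∈p' : w' ∈ blocks' p
    w'∈p' = subst (λ j → w' ∈ blocks' j) (trans (sym (absorb-spec w∈p)) (absorb-id p)) (∈-index' w')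

    -- Any vertex u' in the p-th block of G - v comes from the p-th block of G,
    -- which has room only for v and w.
    only-w' : ∀ {u'} → u' ∈ blocks' p → u' ≡ w'
    only-w' {u'} u'∈p' = punchIn-injective v u' w'
      (atMostTwo small (∈-index v) u∈p w∈p (λ v≡u → punchInᵢ≢i v u' (sym v≡u)) v≢w)
      where
      u∈p : punchIn v u' ∈ blocks p
      u∈p = subst (λ i → punchIn v u' ∈ blocks i)
        (begin
          index (punchIn v u')          ≡⟨ sym (absorb-id _) ⟩
          absorb (index (punchIn v u')) ≡⟨ absorb-spec (∈-index (punchIn v u')) ⟩
          index' u'                     ≡⟨ index-unique' u'∈p' ⟩
          p                             ∎)
        (∈-index (punchIn v u'))
        where open ≡-Reasoning

    -- The p-th block has size 1 in G - v but size 2 in G, so b p would be both.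
    labels-clash : ⊥
    labels-clash = 1≢2 (trans (sym (proj₁ (sizeLabel' p) (∣p∣≡1 w'∈p' only-w')))
                              (proj₂ (sizeLabel p) λ ∣p∣≡1 → ℕ.<⇒≢ (two≤∣p∣ (∈-index v) w∈p v≢w) (sym ∣p∣≡1)))
      where
      1≢2 : 1 ≢ 2
      1≢2 ()

mainTheorem5 : ∀ {n} (G : OGraph (suc n)) (B : Subset (suc n)) →
    HomBlock G B → ∣ B ∣ ℕ.≤ 2 → (v : Fin (suc n)) → v ∈ B →
    ∀ (k : ℕ) (H : Fin k → Fin k → Bool) (b : Fin k → ℕ) →
    HasType G k H b → HasType (G -ᵥ v) k H b → ⊥
mainTheorem5 G B B-hom ∣B∣≤2 v v∈B k H b T T' =
  case any? (λ x' → punchIn v x' ∈? B) of λ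
    { (yes (w' , w∈B)) → WithPartner.labels-clash w' (from-B w∈B) (subst (λ S → ∣ S ∣ ℕ.≤ 2) (sym p≡B) ∣B∣≤2)
    ; (no alone) → alone⇒⊥ λ x' x∈p → alone (x' , subst (punchIn v x' ∈_) p≡B x∈p) }
  where
  open TypeWitness G k H b T using (blocks; index-of-block)
  open Deletion G v T T' using (p; alone⇒⊥; module WithPartner)

  p≡B : blocks p ≡ B
  p≡B = index-of-block B-hom v∈B

  from-B : ∀ {x} → x ∈ B → x ∈ blocks p
  from-B = subst (_ ∈_) (sym p≡B)
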